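{- For any enriched formal $\mathbf{A}$-context $\mathbb{F} = (\mathbb{P}, R_\Box, R_\Diamond)$, \[ \mathbb{F}\models \Box\phi\vdash \phi\quad \mbox{ iff } \quad R_\Box\leq I. \]
   Context: $\mathbf{A}$ is a complete Heyting algebra. $\mathbb{P}=(A,X,I)$ is a formal $\mathbf{A}$-context with $I:A\times X\to\mathbf{A}$, $(\cdot)^\uparrow=I^{(1)}[\cdot]$, $(\cdot)^\downarrow=I^{(0)}[\cdot]$, where for $R:A\times X\to\mathbf{A}$, $R^{(1)}[f](x)=\bigwedge_a(f(a)\to R(a,x))$ and $R^{(0)}[u](a)=\bigwedge_x(u(x)\to R(a,x))$; $\mathbb{P}^+$ is the lattice of formal $\mathbf{A}$-concepts $(f,u)$ with $f^\uparrow=u$, $u^\downarrow=f$. $R_\Box:A\times X\to\mathbf{A}$ and $R_\Diamond:X\times A\to\mathbf{A}$ are $I$-compatible (the sets $R_{\Box}^{(0)}[\{\alpha / x\}]$, $R_{\Box}^{(1)}[\{\alpha / a\}]$, $R_{\Diamond}^{(0)}[\{\alpha / a\}]$, $R_{\Diamond}^{(1)}[\{\alpha / x\}]$ are Galois-stable). $\mathbb{F}\models\Box\phi\vdash\phi$ means $V(\Box\phi)\leq V(\phi)$ for every valuation $V:\mathsf{AtProp}\to\mathbb{P}^+$, where $V(\Box\phi)=(R^{(0)}_\Box[(\![\phi]\!)],(R^{(0)}_\Box[(\![\phi]\!)])^\uparrow)$ with $(\![\phi]\!)$ the intension of $V(\phi)$; $R_\Box\leq I$ means $R_\Box(a,x)\leq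 I(a,x)$ for all $a,x$. -}

module Defs where

open import Level using (Level; _⊔_) renaming (suc to lsuc)
open import Relation.Binary.Structures using (IsPartialOrder)
open import Relation.Binary.PropositionalEquality using (_≡_)
open import Data.Product using (_×_)
open import Function.Bundles using (_⇔_)

record CompleteHeytingAlgebra (c ℓ₁ ℓ₂ ι : Level) : Set (lsuc (c ⊔ ℓ₁ ⊔ ℓ₂ ⊔ ι)) where
  infix  4 _≈_ _≤_
  infixr 5 _⇒_
  infixr 7 _∧_
  field
    Carrier        : Set c
    _≈_            : Carrier → Carrier → Set ℓ₁
    _≤_            : Carrier → Carrier → Set ℓ₂
    isPartialOrder : IsPartialOrder _≈_ _≤_
    ⋀              : {J : Set ι} → (J → Carrier) → Carrier
    ⋀-lower        : {J : Set ι} (g : J → Carrier) (j : J) → ⋀ g ≤ g j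
    ⋀-greatest     : {J : Set ι} (g : J → Carrier) (z : Carrier) →
                     ((j : J) → z ≤ g j) → z ≤ ⋀ g
    ⋁              : {J : Set ι} → (J → Carrier) → Carrier
    ⋁-upper        : {J : Set ι} (g : J → Carrier) (j : J) → g j ≤ ⋁ g
    ⋁-least        : {J : Set ι} (g : J → Carrier) (z : Carrier) →
                     ((j : J) → g j ≤ z) → ⋁ g ≤ z
    _∧_            : Carrier → Carrier → Carrier
    ∧-lowerˡ       : (x y : Carrier) → x ∧ y ≤ x
    ∧-lowerʳ       : (x y : Carrier) → x ∧ y ≤ y
    ∧-greatest     : (x y z : Carrier) → z ≤ x → z ≤ y → z ≤ x ∧ y
    _⇒_            : Carrier → Carrier → Carrier
    residuated     : (x y z : Carrier) → (x ∧ y ≤ z) ⇔ (x ≤ y ⇒ z)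

module FormalContexts {c ℓ₁ ℓ₂ ι : Level} (𝔸 : CompleteHeytingAlgebra c ℓ₁ ℓ₂ ι) where
  open CompleteHeytingAlgebra 𝔸

  𝔸-Subset : Set ι → Set (c ⊔ ι)
  𝔸-Subset B = B → Carrier

  -- the 𝔸-fuzzy singleton {α / b}: value α at b, ⊥ elsewhere
  -- (written constructively as ⋁ over proofs of b ≡ b')
  ⟨_/_⟩ : {B : Set ι} → Carrier → B → 𝔸-Subset B
  ⟨ α / b ⟩ b' = ⋁ {J = b ≡ b'} (λ _ → α)

  _⁽⁰⁾[_] : {B Y : Set ι} → (B → Y → Carrier) → 𝔸-Subset Y → 𝔸-Subset B
  (R ⁽⁰⁾[ u ]) b = ⋀ (λ y → u y ⇒ R b y)

  _⁽¹⁾[_] : {B Y : Set ι} → (B → Y → Carrier) → 𝔸-Subset B → 𝔸-Subset Y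
  (R ⁽¹⁾[ f ]) y = ⋀ (λ b → f b ⇒ R b y)

  _≐_ : {B : Set ι} → 𝔸-Subset B → 𝔸-Subset B → Set (ι ⊔ ℓ₁)
  f ≐ g = ∀ b → f b ≈ g b

  _⊆_ : {B : Set ι} → 𝔸-Subset B → 𝔸-Subset B → Set (ι ⊔ ℓ₂)
  f ⊆ g = ∀ b → f b ≤ g b

  record FormalContext : Set (lsuc ι ⊔ c) where
    field
      A : Set ι
      X : Set ι
      I : A → X → Carrier

  module _ (ℙ : FormalContext) where
    open FormalContext ℙ

    _↑ : 𝔸-Subset A → 𝔸-Subset X
    f ↑ = I ⁽¹⁾[ f ]

    _↓ : 𝔸-Subset X → 𝔸-Subset A
    u ↓ = I ⁽⁰⁾[ u ]

    GaloisStableA : 𝔸-Subset A → Set (ι ⊔ ℓ₁)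
    GaloisStableA f = ((f ↑) ↓) ≐ f

    GaloisStableX : 𝔸-Subset X → Set (ι ⊔ ℓ₁)
    GaloisStableX u = ((u ↓) ↑) ≐ u

    record Concept : Set (c ⊔ ι ⊔ ℓ₁) where
      field
        ext    : 𝔸-Subset A
        int    : 𝔸-Subset X
        ext↑   : (ext ↑) ≐ int
        int↓   : (int ↓) ≐ ext

    _≤⁺_ : (𝔸-Subset A × 𝔸-Subset X) → (𝔸-Subset A × 𝔸-Subset X) → Set (ι ⊔ ℓ₂)
    (f Data.Product., _) ≤⁺ (g Data.Product., _) = f ⊆ g

  record EnrichedContext : Set (lsuc ι ⊔ c ⊔ ℓ₁) where
    field
      ℙ  : FormalContext
    open FormalContext ℙ
    field
      R□ : A → X → Carrier
      R◇ : X → A → Carrier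
      R□-compat₀ : (α : Carrier) (x : X) → GaloisStableA ℙ (R□ ⁽⁰⁾[ ⟨ α / x ⟩ ])
      R□-compat₁ : (α : Carrier) (a : A) → GaloisStableX ℙ (R□ ⁽¹⁾[ ⟨ α / a ⟩ ])
      R◇-compat₀ : (α : Carrier) (a : A) → GaloisStableX ℙ (R◇ ⁽⁰⁾[ ⟨ α / a ⟩ ])
      R◇-compat₁ : (α : Carrier) (x : X) → GaloisStableA ℙ (R◇ ⁽¹⁾[ ⟨ α / x ⟩ ])

  module _ (𝔽 : EnrichedContext) where
    open EnrichedContext 𝔽
    open FormalContext ℙ

    Valuation : Set ι → Set (c ⊔ ι ⊔ ℓ₁)
    Valuation AtProp = AtProp → Concept ℙ

    ⟦_⟧ : {AtProp : Set ι} → AtProp → Valuation AtProp →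
          𝔸-Subset A × 𝔸-Subset X
    ⟦ p ⟧ V = Concept.ext (V p) Data.Product., Concept.int (V p)

    ⟦□_⟧ : {AtProp : Set ι} → AtProp → Valuation AtProp →
           𝔸-Subset A × 𝔸-Subset X
    ⟦□ p ⟧ V = (R□ ⁽⁰⁾[ Concept.int (V p) ]) Data.Product.,
               (_↑ ℙ (R□ ⁽⁰⁾[ Concept.int (V p) ]))

    Valid-□p⊢p : {AtProp : Set ι} → AtProp → Set (c ⊔ ι ⊔ ℓ₁ ⊔ ℓ₂)
    Valid-□p⊢p {AtProp} p = (V : Valuation AtProp) → _≤⁺_ ℙ (⟦□ p ⟧ V) (⟦ p ⟧ V)

    R□≤I : Set (ι ⊔ ℓ₂)
    R□≤I = ∀ a x → R□ a x ≤ I a x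

-- If R□ ≤ I then R□⁽⁰⁾[u] ⊆ I⁽⁰⁾[u] = u↓, which is the extension of every concept
-- with intension u. Conversely, fix a and test validity on the concept whose
-- intension is h = R□⁽¹⁾[{⊤/a}], Galois-stable by I-compatibility: a lies in the
-- closure R□⁽⁰⁾[h] of {⊤/a}, so validity puts a in h↓, i.e. h x ≤ I(a,x); and
-- R□(a,x) ≤ h x because {⊤/a} is supported only at a.
module Submission where

open import Defs
open import Level using (Level; Lift)
open import Function.Bundles using (_⇔_; mk⇔; Equivalence)
open import Data.Empty using (⊥)
open import Relation.Binary.PropositionalEquality using (refl)
open import Relation.Binary.Bundles using (Poset)
open import Relation.Binary.Structures using (IsPartialOrder)
import Relation.Binary.Reasoning.PartialOrder as ≤-Reasoning

module HeytingProperties {c ℓ₁ ℓ₂ ι : Level} (𝔸 : CompleteHeytingAlgebra c ℓ₁ ℓ₂ ι) where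
  open CompleteHeytingAlgebra 𝔸
  open IsPartialOrder isPartialOrder public
    using (reflexive) renaming (refl to ≤-refl; trans to ≤-trans)

  poset : Poset c ℓ₁ ℓ₂
  poset = record { isPartialOrder = isPartialOrder }

  ⊤ : Carrier
  ⊤ = ⋀ {J = Lift ι ⊥} (λ ())

  ≤-⊤ : ∀ x → x ≤ ⊤
  ≤-⊤ x = ⋀-greatest (λ ()) x (λ ())

  ⇒-intro : ∀ {x y z} → x ∧ y ≤ z → x ≤ y ⇒ z
  ⇒-intro = Equivalence.to (residuated _ _ _)

  ⇒-elim : ∀ {x y z} → x ≤ y ⇒ z → x ∧ y ≤ z
  ⇒-elim = Equivalence.from (residuated _ _ _)

  ∧-swap : ∀ x y → x ∧ y ≤ y ∧ x
  ∧-swap x y = ∧-greatest y x (x ∧ y) (∧-lowerʳ x y) (∧-lowerˡ x y)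

  ⇒-exchange : ∀ {x y z} → x ≤ y ⇒ z → y ≤ x ⇒ z
  ⇒-exchange x≤y⇒z = ⇒-intro (≤-trans (∧-swap _ _) (⇒-elim x≤y⇒z))

  ⇒-monoʳ : ∀ {y z z′} → z ≤ z′ → y ⇒ z ≤ y ⇒ z′
  ⇒-monoʳ z≤z′ = ⇒-intro (≤-trans (⇒-elim ≤-refl) z≤z′)

  ≤-⇒-self : ∀ x y → x ≤ y ⇒ y
  ≤-⇒-self x y = ⇒-intro (∧-lowerʳ x y)

  ⊤≤⇒⇒≤ : ∀ {y z} → ⊤ ≤ y ⇒ z → y ≤ z
  ⊤≤⇒⇒≤ {y} ⊤≤y⇒z = ≤-trans (∧-greatest ⊤ y y (≤-⊤ y) ≤-refl) (⇒-elim ⊤≤y⇒z)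

module DerivationOperators {c ℓ₁ ℓ₂ ι : Level} (𝔸 : CompleteHeytingAlgebra c ℓ₁ ℓ₂ ι) where
  open CompleteHeytingAlgebra 𝔸
  open FormalContexts 𝔸
  open HeytingProperties 𝔸

  ≤-singleton : {B : Set ι} (α : Carrier) (b : B) → α ≤ ⟨ α / b ⟩ b
  ≤-singleton α b = ⋁-upper (λ _ → α) refl

  module _ {B Y : Set ι} where

    ⁽⁰⁾-monoˡ : {R S : B → Y → Carrier} → (∀ b y → R b y ≤ S b y) →
                (u : 𝔸-Subset Y) → (R ⁽⁰⁾[ u ]) ⊆ (S ⁽⁰⁾[ u ])
    ⁽⁰⁾-monoˡ R≤S u b = ⋀-greatest _ _ λ y →
      ≤-trans (⋀-lower (λ y → u y ⇒ _) y) (⇒-monoʳ (R≤S b y))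

    ⊆-⁽⁰⁾⁽¹⁾ : (R : B → Y → Carrier) (f : 𝔸-Subset B) → f ⊆ (R ⁽⁰⁾[ R ⁽¹⁾[ f ] ])
    ⊆-⁽⁰⁾⁽¹⁾ R f b = ⋀-greatest _ _ λ y →
      ⇒-exchange (⋀-lower (λ b′ → f b′ ⇒ R b′ y) b)

    ≤-⁽¹⁾-singleton : (R : B → Y → Carrier) (α : Carrier) (b : B) (y : Y) →
                      R b y ≤ (R ⁽¹⁾[ ⟨ α / b ⟩ ]) y
    ≤-⁽¹⁾-singleton R α b y = ⋀-greatest _ _ λ b′ →
      ⇒-exchange (⋁-least _ _ λ { refl → ≤-⇒-self α (R b y) })

  module _ (ℙ : FormalContext) where
    open FormalContext ℙ

    stable⇒Concept : {u : 𝔸-Subset X} → GaloisStableX ℙ u → Concept ℙ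
    stable⇒Concept {u} stable = record
      { ext  = _↓ ℙ u
      ; int  = u
      ; ext↑ = stable
      ; int↓ = λ _ → IsPartialOrder.Eq.refl isPartialOrder
      }

module BoxReflexivity {c ℓ₁ ℓ₂ ι : Level} (𝔸 : CompleteHeytingAlgebra c ℓ₁ ℓ₂ ι)
  (𝔽 : FormalContexts.EnrichedContext 𝔸) where
  open CompleteHeytingAlgebra 𝔸
  open FormalContexts 𝔸
  open EnrichedContext 𝔽
  open FormalContext ℙ
  open HeytingProperties 𝔸
  open DerivationOperators 𝔸

  R□≤I⇒valid : R□≤I 𝔽 → {AtProp : Set ι} (p : AtProp) → Valid-□p⊢p 𝔽 p
  R□≤I⇒valid R□≤I p V a =
    ≤-trans (⁽⁰⁾-monoˡ R□≤I (Concept.int (V p)) a) (reflexive (Concept.int↓ (V p) a))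

  valid⇒R□≤I : {AtProp : Set ι} (p : AtProp) → Valid-□p⊢p 𝔽 p → R□≤I 𝔽
  valid⇒R□≤I p valid a x =
    ≤-trans (≤-⁽¹⁾-singleton R□ ⊤ a x) (⊤≤⇒⇒≤ ⊤≤hx⇒Iax)
    where
    open ≤-Reasoning poset

    h : 𝔸-Subset X
    h = R□ ⁽¹⁾[ ⟨ ⊤ / a ⟩ ]

    ⊤≤hx⇒Iax : ⊤ ≤ h x ⇒ I a x
    ⊤≤hx⇒Iax = begin
      ⊤                  ≤⟨ ≤-singleton ⊤ a ⟩
      ⟨ ⊤ / a ⟩ a        ≤⟨ ⊆-⁽⁰⁾⁽¹⁾ R□ ⟨ ⊤ / a ⟩ a ⟩
      (R□ ⁽⁰⁾[ h ]) a    ≤⟨ valid (λ _ → stable⇒Concept ℙ (R□-compat₁ ⊤ a)) a ⟩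
      (_↓ ℙ h) a         ≤⟨ ⋀-lower (λ y → h y ⇒ I a y) x ⟩
      h x ⇒ I a x        ∎

proposition5p9 : {c ℓ₁ ℓ₂ ι : Level} (𝔸 : CompleteHeytingAlgebra c ℓ₁ ℓ₂ ι)
    (𝔽 : FormalContexts.EnrichedContext 𝔸)
    (AtProp : Set ι) (p : AtProp) →
    FormalContexts.Valid-□p⊢p 𝔸 𝔽 p ⇔ FormalContexts.R□≤I 𝔸 𝔽
proposition5p9 𝔸 𝔽 AtProp p =
  mk⇔ (valid⇒R□≤I p) (λ R□≤I → R□≤I⇒valid R□≤I p)
  where open BoxReflexivity 𝔸 𝔽
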